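{- For every integer $n\ge 2$ and every $i\in\{1,\ldots,n-1\}$, $fw(1\,2\ldots n\;1\,2\ldots n\;i)=4$.
   Context: Sequences are written as concatenations of letters. A sequence $s$ contains $u$ if some (not necessarily contiguous) subsequence of $s$ can be changed into $u$ by a one-to-one renaming of letters. An $(r,s)$-formation is a concatenation of $s$ permutations, each of the same set of $r$ distinct letters. The formation width $fw(u)$ is the minimum $s$ such that there exists $r$ for which every $(r,s)$-formation contains $u$. -}

module Defs where

open import Data.Nat using (ℕ; suc; _<_)
open import Data.List using (List; []; _∷_; _++_; map; concat; length; upTo)
open import Data.List.Membership.Propositional using (_∈_)
open import Data.List.Relation.Unary.All using (All)
open import Data.List.Relation.Unary.Unique.Propositional using (Unique)
open import Data.List.Relation.Binary.Permutation.Propositional using (_↭_)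
open import Data.List.Relation.Binary.Sublist.Propositional using (_⊆_)
open import Data.Product using (Σ; _×_; ∃; ∃-syntax)
open import Relation.Binary.PropositionalEquality using (_≡_)
open import Relation.Nullary using (¬_)

Seq : Set
Seq = List ℕ

Contains : Seq → Seq → Set
Contains s u =
  ∃[ t ] (t ⊆ s × ∃[ f ] ((∀ x y → x ∈ t → y ∈ t → f x ≡ f y → x ≡ y) × map f t ≡ u))

IsFormation : ℕ → ℕ → Seq → Set
IsFormation r s w =
  ∃[ L ] (Unique L × length L ≡ r ×
    ∃[ ps ] (length ps ≡ s × All (_↭ L) ps × w ≡ concat ps))

FormationForced : Seq → ℕ → Set
FormationForced u s = ∃[ r ] (∀ w → IsFormation r s w → Contains w u)

FwEq : Seq → ℕ → Set
FwEq u k = FormationForced u k × (∀ s → s < k → ¬ FormationForced u s)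

oneTo : ℕ → Seq
oneTo n = map suc (upTo n)

pat : ℕ → ℕ → Seq
pat n i = oneTo n ++ oneTo n ++ (i ∷ [])

-- Upper bound: by an Erdős–Szekeres argument, two permutations of a long enough
-- list share either n letters in the same order or many letters in opposite
-- orders.  Applying this to the first two permutations, and then once more to
-- a set they order oppositely against the third, yields n letters S in the
-- same order in two of the first three permutations; S S z, with z the i-th
-- letter of S taken from a later permutation, is then an occurrence of
-- 1…n 1…n i.  Lower bound: for i < n the pattern contains i n i n i, hence
-- forces an alternation a b a b a, and the 3-formation (0…r-1)(r-1…0)(0…r-1)
-- has none: a strictly monotone run holds no x y x, so each run takes at most
-- two consecutive letters of a b a b a, and the two runs taking two letters
-- would compare a and b both ways.
module Submission where

open import Defs
open import Data.Nat using (ℕ; zero; suc; _+_; _≤_; _<_; _>_; _≟_; _≤?_; z≤n; s≤s)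
open import Data.Nat.Properties
  using (<⇒≤; +-suc; +-monoˡ-≤; +-cancelˡ-≤; n≤1+n; ≰⇒>; ≤-trans; ≤-reflexive; <-irrefl; <-asym; suc-injective; m≤n⇒m⊓n≡m; module ≤-Reasoning)
open import Data.Empty using (⊥; ⊥-elim)
open import Data.Sum using (_⊎_; inj₁; inj₂; [_,_]′)
open import Data.Product using (∃₂; ∃-syntax; _×_; _,_)
open import Function using (_∘_; id)
open import Data.List using (List; []; _∷_; [_]; _++_; map; concat; length; reverse; filter; take; drop; upTo; downFrom)
open import Data.List.Properties
  using (++-identityʳ; map-++; map-∘; map-upTo; map-cong-local; upTo-∷ʳ; reverse-upTo; unfold-reverse; length-reverse; length-take; length-upTo; concat-++; take++drop≡id)
open import Data.List.Membership.Propositional using (_∈_; _∉_)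
open import Data.List.Membership.Propositional.Properties using (∈-∃++; ∈-++⁻; ∈-map⁺; ∈-map⁻; ∈-upTo⁺; ∈-filter⁻)
open import Data.List.Membership.DecPropositional _≟_ using (_∈?_)
open import Data.List.Relation.Unary.All as All using (All; []; _∷_)
open import Data.List.Relation.Unary.All.Properties using (all-filter; take⁺) renaming (++⁺ to All-++⁺)
open import Data.List.Relation.Unary.Any as Any using (here; there)
open import Data.List.Relation.Unary.AllPairs using (AllPairs; []; _∷_)
open import Data.List.Relation.Unary.AllPairs.Properties using (applyUpTo⁺₁; applyDownFrom⁺₁)
open import Data.List.Relation.Unary.Unique.Propositional using (Unique)
open import Data.List.Relation.Unary.Unique.Propositional.Properties using (upTo⁺; filter⁺)
open import Data.List.Relation.Binary.Pointwise using (Pointwise; []; _∷_; ≡⇒Pointwise-≡)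
import Data.List.Relation.Binary.Pointwise as Pointwise
open import Data.List.Relation.Binary.Permutation.Propositional using (_↭_; ↭-refl; ↭-sym; ↭-trans; ↭⇒↭ₛ)
open import Data.List.Relation.Binary.Permutation.Propositional.Properties using (∈-resp-↭; ↭-length; ↭-reverse)
import Data.List.Relation.Binary.Permutation.Setoid.Properties as Permutationₛ
open import Data.List.Relation.Binary.Sublist.Propositional using (_⊆_; []; _∷_; _∷ʳ_; ⊆-refl; ⊆-reflexive; ⊆-trans; minimum; from∈)
open import Data.List.Relation.Binary.Sublist.Propositional.Properties
  using (++⁺; ++⁺ˡ; ++⁺ʳ; reverse⁺; map⁺; All-resp-⊆; Any-resp-⊆; filter-⊆)
open import Relation.Binary.PropositionalEquality using (_≡_; _≢_; refl; sym; trans; cong; cong₂; subst; setoid; module ≡-Reasoning)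
open import Relation.Nullary using (¬_; yes; no)
open import Relation.Unary using (Pred; Decidable)
open import Relation.Unary.Properties using (∁?)

AllPairs-resp-⊆ : ∀ {A : Set} {R : A → A → Set} {xs ys} → xs ⊆ ys → AllPairs R ys → AllPairs R xs
AllPairs-resp-⊆ []           []           = []
AllPairs-resp-⊆ (y ∷ʳ xs⊆ys) (_ ∷ Rys)    = AllPairs-resp-⊆ xs⊆ys Rys
AllPairs-resp-⊆ (refl ∷ xs⊆ys) (Ry ∷ Rys) = All-resp-⊆ xs⊆ys Ry ∷ AllPairs-resp-⊆ xs⊆ys Rys

Unique-resp-↭ : ∀ {A : Set} {xs ys : List A} → xs ↭ ys → Unique xs → Unique ys
Unique-resp-↭ {A} = Permutationₛ.Unique-resp-↭ (setoid A) ∘ ↭⇒↭ₛ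

↭⇒All∈ : ∀ {A : Set} {xs ys : List A} → xs ↭ ys → All (_∈ ys) xs
↭⇒All∈ xs↭ys = All.tabulate (∈-resp-↭ xs↭ys)

⊆-++⁻ : ∀ {A : Set} (ys : List A) {xs zs} → xs ⊆ ys ++ zs → ∃[ k ] (take k xs ⊆ ys × drop k xs ⊆ zs)
⊆-++⁻ []       xs⊆zs          = 0 , [] , xs⊆zs
⊆-++⁻ (y ∷ ys) (.y ∷ʳ xs⊆)    with k , ⊆ys , ⊆zs ← ⊆-++⁻ ys xs⊆ = k , y ∷ʳ ⊆ys , ⊆zs
⊆-++⁻ (y ∷ ys) (refl ∷ xs⊆)   with k , ⊆ys , ⊆zs ← ⊆-++⁻ ys xs⊆ = suc k , refl ∷ ⊆ys , ⊆zs

⊆-map⁻ : ∀ {A : Set} (f : A → A) t {u} → u ⊆ map f t → ∃[ t′ ] (t′ ⊆ t × map f t′ ≡ u)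
⊆-map⁻ f []      []           = [] , [] , refl
⊆-map⁻ f (x ∷ t) (_ ∷ʳ u⊆)    with t′ , t′⊆t , eq ← ⊆-map⁻ f t u⊆ = t′ , x ∷ʳ t′⊆t , eq
⊆-map⁻ f (x ∷ t) (refl ∷ u⊆)  with t′ , t′⊆t , eq ← ⊆-map⁻ f t u⊆ = x ∷ t′ , refl ∷ t′⊆t , cong (f x ∷_) eq

concat-take-⊆ : ∀ {A : Set} n (xss : List (List A)) → concat (take n xss) ⊆ concat xss
concat-take-⊆ n xss = subst (concat (take n xss) ⊆_) concat≡ (++⁺ʳ (concat (drop n xss)) ⊆-refl)
  where
  concat≡ : concat (take n xss) ++ concat (drop n xss) ≡ concat xss
  concat≡ = trans (concat-++ (take n xss) (drop n xss)) (cong concat (take++drop≡id n xss))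

∈-++-∷⁻ : ∀ {x y : ℕ} B₁ {B₂} → y ∈ B₁ ++ x ∷ B₂ → x ≢ y → y ∉ B₂ → y ∈ B₁
∈-++-∷⁻ B₁ y∈B x≢y y∉B₂ with ∈-++⁻ B₁ y∈B
... | inj₁ y∈B₁         = y∈B₁
... | inj₂ (here y≡x)   = ⊥-elim (x≢y (sym y≡x))
... | inj₂ (there y∈B₂) = ⊥-elim (y∉B₂ y∈B₂)

InjectiveOn : (ℕ → ℕ) → Seq → Set
InjectiveOn f t = ∀ x y → x ∈ t → y ∈ t → f x ≡ f y → x ≡ y

Contains-monoˡ : ∀ {w w′ u} → w ⊆ w′ → Contains w u → Contains w′ u
Contains-monoˡ w⊆w′ (t , t⊆w , f , inj , ft≡u) = t , ⊆-trans t⊆w w⊆w′ , f , inj , ft≡u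

Contains-antimonoʳ : ∀ {w u v} → v ⊆ u → Contains w u → Contains w v
Contains-antimonoʳ v⊆u (t , t⊆w , f , inj , refl)
  with t′ , t′⊆t , ft′≡v ← ⊆-map⁻ f t v⊆u
  = t′ , ⊆-trans t′⊆t t⊆w , f , inj′ , ft′≡v
  where
  inj′ : InjectiveOn f t′
  inj′ x y x∈t′ y∈t′ = inj x y (Any-resp-⊆ t′⊆t x∈t′) (Any-resp-⊆ t′⊆t y∈t′)

esBound : ℕ → ℕ → ℕ
esBound zero    b       = 0
esBound (suc a) zero    = 0
esBound (suc a) (suc b) = suc (esBound a (suc b) + esBound (suc a) b)

CommonSubsequence : ℕ → Seq → Seq → Set
CommonSubsequence k A B = ∃[ S ] (length S ≡ k × S ⊆ A × S ⊆ B)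

ReversedSubsequence : ℕ → Seq → Seq → Set
ReversedSubsequence k A B = ∃[ S ] (length S ≡ k × S ⊆ A × reverse S ⊆ B)

CommonSubsequence-mono : ∀ {k A A′ B B′} → A ⊆ A′ → B ⊆ B′ →
                         CommonSubsequence k A B → CommonSubsequence k A′ B′
CommonSubsequence-mono A⊆ B⊆ (S , |S| , S⊆A , S⊆B) = S , |S| , ⊆-trans S⊆A A⊆ , ⊆-trans S⊆B B⊆

ReversedSubsequence-mono : ∀ {k A A′ B B′} → A ⊆ A′ → B ⊆ B′ →
                           ReversedSubsequence k A B → ReversedSubsequence k A′ B′
ReversedSubsequence-mono A⊆ B⊆ (S , |S| , S⊆A , S⊆B) = S , |S| , ⊆-trans S⊆A A⊆ , ⊆-trans S⊆B B⊆

length-filter-∁ : ∀ {a p} {A : Set a} {P : Pred A p} (P? : Decidable P) xs →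
                  length (filter P? xs) + length (filter (∁? P?) xs) ≡ length xs
length-filter-∁ P? []       = refl
length-filter-∁ P? (x ∷ xs) with P? x
... | yes _ = cong suc (length-filter-∁ P? xs)
... | no  _ = trans (+-suc _ _) (cong suc (length-filter-∁ P? xs))

+-≤-split : ∀ {p q m n} → p + q ≤ m + n → p ≤ m ⊎ q ≤ n
+-≤-split {p} {q} {m} {n} p+q≤m+n with p ≤? m
... | yes p≤m = inj₁ p≤m
... | no  p≰m = inj₂ (+-cancelˡ-≤ (suc m) q n (begin
  suc m + q ≤⟨ +-monoˡ-≤ q (≰⇒> p≰m) ⟩
  p + q     ≤⟨ p+q≤m+n ⟩
  m + n     ≤⟨ n≤1+n (m + n) ⟩
  suc m + n ∎))
  where open ≤-Reasoning

-- Split B around the first letter x of A: the rest of A is divided into the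
-- letters after x in B (A₂) and those before it (A₁); one part is long enough
-- for the induction, and x extends its result in the matching direction.
erdős-szekeres : ∀ a b {A B} → Unique A → All (_∈ B) A → esBound a b ≤ length A →
                 CommonSubsequence a A B ⊎ ReversedSubsequence b A B
erdős-szekeres zero    b       _ _ _ = inj₁ ([] , refl , minimum _ , minimum _)
erdős-szekeres (suc a) zero    _ _ _ = inj₂ ([] , refl , minimum _ , minimum _)
erdős-szekeres (suc a) (suc b) {x ∷ A} (x∉A ∷ uA) (x∈B ∷ A∈B) (s≤s bound)
  with B₁ , B₂ , refl ← ∈-∃++ x∈B
  = [ after , before ]′ (+-≤-split (≤-trans bound (≤-reflexive (sym (length-filter-∁ (_∈? B₂) A)))))
  where
  A₂ = filter (_∈? B₂) A
  A₁ = filter (∁? (_∈? B₂)) A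

  A₁∈B₁ : All (_∈ B₁) A₁
  A₁∈B₁ = All.tabulate λ y∈A₁ → let y∈A , y∉B₂ = ∈-filter⁻ (∁? (_∈? B₂)) y∈A₁ in
    ∈-++-∷⁻ B₁ (All.lookup A∈B y∈A) (All.lookup x∉A y∈A) y∉B₂

  after : esBound a (suc b) ≤ length A₂ →
          CommonSubsequence (suc a) (x ∷ A) (B₁ ++ x ∷ B₂) ⊎ ReversedSubsequence (suc b) (x ∷ A) (B₁ ++ x ∷ B₂)
  after enough with erdős-szekeres a (suc b) (filter⁺ (_∈? B₂) uA) (all-filter (_∈? B₂) A) enough
  ... | inj₁ (S , |S| , S⊆A₂ , S⊆B₂) =
    inj₁ (x ∷ S , cong suc |S| , refl ∷ ⊆-trans S⊆A₂ (filter-⊆ _ A) , ++⁺ˡ B₁ (refl ∷ S⊆B₂))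
  ... | inj₂ reversed = inj₂ (ReversedSubsequence-mono (x ∷ʳ filter-⊆ _ A) (++⁺ˡ B₁ (x ∷ʳ ⊆-refl)) reversed)

  before : esBound (suc a) b ≤ length A₁ →
           CommonSubsequence (suc a) (x ∷ A) (B₁ ++ x ∷ B₂) ⊎ ReversedSubsequence (suc b) (x ∷ A) (B₁ ++ x ∷ B₂)
  before enough with erdős-szekeres (suc a) b (filter⁺ (∁? (_∈? B₂)) uA) A₁∈B₁ enough
  ... | inj₁ common = inj₁ (CommonSubsequence-mono (x ∷ʳ filter-⊆ _ A) (++⁺ʳ (x ∷ B₂) ⊆-refl) common)
  ... | inj₂ (S , |S| , S⊆A₁ , rS⊆B₁) =
    inj₂ (x ∷ S , cong suc |S| , refl ∷ ⊆-trans S⊆A₁ (filter-⊆ _ A) ,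
          subst (_⊆ B₁ ++ x ∷ B₂) (sym (unfold-reverse x S)) (++⁺ rS⊆B₁ (refl ∷ minimum B₂)))

-- 1-based; 0 for letters not in the list.
position : Seq → ℕ → ℕ
position []       z = 0
position (y ∷ ys) z with z ≟ y
... | yes _ = 1
... | no  _ = suc (position ys z)

position-head : ∀ y ys → position (y ∷ ys) y ≡ 1
position-head y ys with y ≟ y
... | yes _  = refl
... | no y≢y = ⊥-elim (y≢y refl)

position-tail : ∀ {y z} ys → y ≢ z → position (y ∷ ys) z ≡ suc (position ys z)
position-tail {y} {z} ys y≢z with z ≟ y
... | yes z≡y = ⊥-elim (y≢z (sym z≡y))
... | no  _   = refl

position-pos : ∀ {z ys} → z ∈ ys → 0 < position ys z
position-pos {z} {y ∷ ys} _ with z ≟ y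
... | yes _ = s≤s z≤n
... | no  _ = s≤s z≤n

position-injective : ∀ S → InjectiveOn (position S) S
position-injective (y ∷ S) x z x∈ z∈ eq with x ≟ y | z ≟ y
... | yes x≡y | yes z≡y = trans x≡y (sym z≡y)
... | yes _   | no  z≢y = ⊥-elim (<-irrefl (suc-injective eq) (position-pos (Any.tail z≢y z∈)))
... | no  x≢y | yes _   = ⊥-elim (<-irrefl (sym (suc-injective eq)) (position-pos (Any.tail x≢y x∈)))
... | no  x≢y | no  z≢y = position-injective S x z (Any.tail x≢y x∈) (Any.tail z≢y z∈) (suc-injective eq)

oneTo-suc : ∀ k → oneTo (suc k) ≡ 1 ∷ map suc (oneTo k)
oneTo-suc k = cong (λ l → 1 ∷ map suc l) (sym (map-upTo suc k))

map-position : ∀ {S} → Unique S → map (position S) S ≡ oneTo (length S)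
map-position {[]}    []         = refl
map-position {y ∷ S} (y∉S ∷ uS) = begin
  position (y ∷ S) y ∷ map (position (y ∷ S)) S
    ≡⟨ cong₂ _∷_ (position-head y S) (map-cong-local (All.map (position-tail S) y∉S)) ⟩
  1 ∷ map (suc ∘ position S) S
    ≡⟨ cong (1 ∷_) (trans (map-∘ S) (cong (map suc) (map-position uS))) ⟩
  1 ∷ map suc (oneTo (length S))
    ≡⟨ sym (oneTo-suc (length S)) ⟩
  oneTo (length (y ∷ S)) ∎
  where open ≡-Reasoning

∈-oneTo : ∀ {i n} → 1 ≤ i → i ≤ n → i ∈ oneTo n
∈-oneTo {suc j} (s≤s _) j<n = ∈-map⁺ suc (∈-upTo⁺ j<n)

SSz-contains-pat : ∀ {S z} → Unique S → z ∈ S → Contains (S ++ S ++ [ z ]) (pat (length S) (position S z))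
SSz-contains-pat {S} {z} uS z∈S = S ++ S ++ [ z ] , ⊆-refl , position S , inj , renamed
  where
  inj : InjectiveOn (position S) (S ++ S ++ [ z ])
  inj x y x∈ y∈ = position-injective S x y (All.lookup all∈S x∈) (All.lookup all∈S y∈)
    where
    all∈S : All (_∈ S) (S ++ S ++ [ z ])
    all∈S = All-++⁺ (All.tabulate id) (All-++⁺ (All.tabulate id) (z∈S ∷ []))

  renamed : map (position S) (S ++ S ++ [ z ]) ≡ pat (length S) (position S z)
  renamed = begin
    map (position S) (S ++ S ++ [ z ])
      ≡⟨ map-++ (position S) S (S ++ [ z ]) ⟩
    map (position S) S ++ map (position S) (S ++ [ z ])
      ≡⟨ cong (map (position S) S ++_) (map-++ (position S) S [ z ]) ⟩
    map (position S) S ++ map (position S) S ++ [ position S z ]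
      ≡⟨ cong (λ l → l ++ l ++ [ position S z ]) (map-position uS) ⟩
    pat (length S) (position S z) ∎
    where open ≡-Reasoning

SSZ-contains-pat : ∀ {S Z i} → Unique S → All (_∈ Z) S → 1 ≤ i → i ≤ length S →
                   Contains (S ++ S ++ Z) (pat (length S) i)
SSZ-contains-pat {S} uS S∈Z 1≤i i≤|S|
  with z , z∈S , refl ← ∈-map⁻ (position S) (subst (_ ∈_) (sym (map-position uS)) (∈-oneTo 1≤i i≤|S|))
  = Contains-monoˡ (++⁺ (⊆-refl {x = S}) (++⁺ (⊆-refl {x = S}) (from∈ (All.lookup S∈Z z∈S)))) (SSz-contains-pat uS z∈S)

common-contains-pat : ∀ {n i X Y Z} → Unique X → All (_∈ Z) X → CommonSubsequence n X Y →
                      1 ≤ i → i ≤ n → Contains (X ++ Y ++ Z) (pat n i)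
common-contains-pat uX X∈Z (S , refl , S⊆X , S⊆Y) 1≤i i≤n =
  Contains-monoˡ (++⁺ S⊆X (++⁺ S⊆Y ⊆-refl))
    (SSZ-contains-pat (AllPairs-resp-⊆ S⊆X uX) (All-resp-⊆ S⊆X X∈Z) 1≤i i≤n)

module _ {L : Seq} (uL : Unique L) where

  private
    unique : ∀ {P} → P ↭ L → Unique P
    unique p = Unique-resp-↭ (↭-sym p) uL

    within : ∀ {P Q} → P ↭ L → Q ↭ L → All (_∈ Q) P
    within p q = ↭⇒All∈ (↭-trans p (↭-sym q))

  four-permutations-contain-pat : ∀ {n i P₁ P₂ P₃ P₄} → esBound n (esBound n n) ≤ length L →
                                  All (_↭ L) (P₁ ∷ P₂ ∷ P₃ ∷ P₄ ∷ []) → 1 ≤ i → i ≤ n →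
                                  Contains (concat (P₁ ∷ P₂ ∷ P₃ ∷ P₄ ∷ [])) (pat n i)
  four-permutations-contain-pat {n} {P₁ = P₁} {P₂} {P₃} {P₄} bound (p₁ ∷ p₂ ∷ p₃ ∷ p₄ ∷ []) 1≤i i≤n
    with erdős-szekeres n (esBound n n) (unique p₁) (within p₁ p₂) (≤-trans bound (≤-reflexive (sym (↭-length p₁))))
  ... | inj₁ common₁₂ =
    Contains-monoˡ (++⁺ (⊆-refl {x = P₁}) (++⁺ (⊆-refl {x = P₂}) (++⁺ʳ (P₄ ++ []) ⊆-refl)))
      (common-contains-pat (unique p₁) (within p₁ p₃) common₁₂ 1≤i i≤n)
  ... | inj₂ (T , |T| , T⊆P₁ , rT⊆P₂)
    with erdős-szekeres n n (AllPairs-resp-⊆ T⊆P₁ (unique p₁)) (All-resp-⊆ T⊆P₁ (within p₁ p₃)) (≤-reflexive (sym |T|))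
  ...   | inj₁ common₁₃ =
    Contains-monoˡ (++⁺ (⊆-refl {x = P₁}) (++⁺ˡ P₂ (++⁺ (⊆-refl {x = P₃}) (++⁺ʳ [] ⊆-refl))))
      (common-contains-pat (unique p₁) (within p₁ p₄) (CommonSubsequence-mono T⊆P₁ ⊆-refl common₁₃) 1≤i i≤n)
  ...   | inj₂ (S , |S| , S⊆T , rS⊆P₃) =
    Contains-monoˡ (++⁺ˡ P₁ (++⁺ (⊆-refl {x = P₂}) (++⁺ (⊆-refl {x = P₃}) (++⁺ʳ [] ⊆-refl))))
      (common-contains-pat (unique p₂) (within p₂ p₄) common₂₃ 1≤i i≤n)
    where
    common₂₃ : CommonSubsequence n P₂ _
    common₂₃ = reverse S , trans (length-reverse S) |S| , ⊆-trans (reverse⁺ S⊆T) rT⊆P₂ , rS⊆P₃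

forced-by-4 : ∀ {n i} → 1 ≤ i → i ≤ n → FormationForced (pat n i) 4
forced-by-4 {n} {i} 1≤i i≤n = esBound n (esBound n n) , forced
  where
  forced : ∀ w → IsFormation (esBound n (esBound n n)) 4 w → Contains w (pat n i)
  forced _ (L , uL , |L| , _ ∷ _ ∷ _ ∷ _ ∷ [] , refl , perms , refl) =
    four-permutations-contain-pat uL (≤-reflexive (sym |L|)) perms 1≤i i≤n

alternation : ℕ → ℕ → Seq
alternation a b = a ∷ b ∷ a ∷ b ∷ a ∷ []

alternation⊆pat : ∀ {n i} → 1 ≤ i → i < n → alternation i n ⊆ pat n i
alternation⊆pat {suc m} {suc j} (s≤s _) (s≤s j<m) = ++⁺ i∷n⊆ (++⁺ i∷n⊆ (refl ∷ []))
  where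
  i∷n⊆ : suc j ∷ suc m ∷ [] ⊆ oneTo (suc m)
  i∷n⊆ = subst (λ l → suc j ∷ suc m ∷ [] ⊆ map suc l) (upTo-∷ʳ m)
    (map⁺ suc (++⁺ (from∈ (∈-upTo⁺ j<m)) ⊆-refl))

alternation-preimage : ∀ {f t i j} → Pointwise (λ x y → f x ≡ y) t (alternation i j) → InjectiveOn f t →
                       ∃₂ λ a b → t ≡ alternation a b
alternation-preimage {t = a ∷ b ∷ c ∷ d ∷ e ∷ []} (fa ∷ fb ∷ fc ∷ fd ∷ fe ∷ []) inj
  with refl ← inj a c (here refl) (there (there (here refl))) (trans fa (sym fc))
  with refl ← inj b d (there (here refl)) (there (there (there (here refl)))) (trans fb (sym fd))
  with refl ← inj a e (here refl) (there (there (there (there (here refl))))) (trans fa (sym fe))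
  = a , b , refl

Contains-alternation : ∀ {w i j} → Contains w (alternation i j) → ∃₂ λ a b → alternation a b ⊆ w
Contains-alternation {i = i} {j} (t , t⊆w , f , inj , ft≡alt)
  with a , b , refl ← alternation-preimage (Pointwise.map⁻ {ys = alternation i j} f id (≡⇒Pointwise-≡ ft≡alt)) inj
  = a , b , t⊆w

¬AllPairs-xyx : ∀ {A : Set} {R : A → A → Set} {x y l} → (∀ {z} → ¬ R z z) → ¬ AllPairs R (x ∷ y ∷ x ∷ l)
¬AllPairs-xyx irrefl ((_ ∷ Rxx ∷ _) ∷ _) = irrefl Rxx

alternation⊈runs : ∀ {a b I D J} → AllPairs _<_ I → AllPairs _>_ D → AllPairs _<_ J →
                   ¬ alternation a b ⊆ I ++ D ++ J
alternation⊈runs {a} {b} {I} {D} incI decD incJ alt⊆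
  with k , ⊆I , ⊆DJ ← ⊆-++⁻ I alt⊆
  with m , ⊆D , ⊆J ← ⊆-++⁻ D ⊆DJ
  = runs k m (AllPairs-resp-⊆ ⊆I incI) (AllPairs-resp-⊆ ⊆D decD) (AllPairs-resp-⊆ ⊆J incJ)
  where
  w = alternation a b
  <-irrefl′ : ∀ {z} → ¬ z < z
  <-irrefl′ = <-irrefl refl
  runs : ∀ k m → AllPairs _<_ (take k w) → AllPairs _>_ (take m (drop k w)) → AllPairs _<_ (drop m (drop k w)) → ⊥
  runs 0 0 _ _ r = ¬AllPairs-xyx <-irrefl′ r
  runs 0 1 _ _ r = ¬AllPairs-xyx <-irrefl′ r
  runs 0 2 _ _ r = ¬AllPairs-xyx <-irrefl′ r
  runs 0 (suc (suc (suc _))) _ q _ = ¬AllPairs-xyx <-irrefl′ q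
  runs 1 0 _ _ r = ¬AllPairs-xyx <-irrefl′ r
  runs 1 1 _ _ r = ¬AllPairs-xyx <-irrefl′ r
  runs 1 2 _ ((a<b ∷ []) ∷ _) ((b<a ∷ []) ∷ _) = <-asym a<b b<a
  runs 1 (suc (suc (suc _))) _ q _ = ¬AllPairs-xyx <-irrefl′ q
  runs 2 0 _ _ r = ¬AllPairs-xyx <-irrefl′ r
  runs 2 1 ((a<b ∷ []) ∷ _) _ ((b<a ∷ []) ∷ _) = <-asym a<b b<a
  runs 2 2 ((a<b ∷ []) ∷ _) ((b<a ∷ []) ∷ _) _ = <-asym a<b b<a
  runs 2 (suc (suc (suc _))) _ q _ = ¬AllPairs-xyx <-irrefl′ q
  runs (suc (suc (suc _))) _ p _ _ = ¬AllPairs-xyx <-irrefl′ p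

upDownUp : ℕ → List Seq
upDownUp r = upTo r ∷ downFrom r ∷ upTo r ∷ []

upDownUp-avoids : ∀ r {n i} → 1 ≤ i → i < n → ¬ Contains (concat (upDownUp r)) (pat n i)
upDownUp-avoids r 1≤i i<n contains
  with a , b , alt⊆ ← Contains-alternation (Contains-antimonoʳ (alternation⊆pat 1≤i i<n) contains)
  = alternation⊈runs increasing decreasing (AllPairs-resp-⊆ (⊆-reflexive (++-identityʳ (upTo r))) increasing) alt⊆
  where
  increasing : AllPairs _<_ (upTo r)
  increasing = applyUpTo⁺₁ id r (λ i<j _ → i<j)
  decreasing : AllPairs _>_ (downFrom r)
  decreasing = applyDownFrom⁺₁ id r (λ j<i _ → j<i)

upDownUp-prefix : ∀ r {s} → s ≤ 3 → IsFormation r s (concat (take s (upDownUp r)))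
upDownUp-prefix r {s} s≤3 =
  upTo r , upTo⁺ r , length-upTo r ,
  take s (upDownUp r) , trans (length-take s (upDownUp r)) (m≤n⇒m⊓n≡m s≤3) ,
  take⁺ s (↭-refl ∷ downFrom↭upTo ∷ ↭-refl ∷ []) , refl
  where
  downFrom↭upTo : downFrom r ↭ upTo r
  downFrom↭upTo = subst (_↭ upTo r) (reverse-upTo r) (↭-reverse (upTo r))

not-forced-below-4 : ∀ {n i s} → 1 ≤ i → i < n → s < 4 → ¬ FormationForced (pat n i) s
not-forced-below-4 {s = s} 1≤i i<n (s≤s s≤3) (r , forced) =
  upDownUp-avoids r 1≤i i<n
    (Contains-monoˡ (concat-take-⊆ s (upDownUp r)) (forced _ (upDownUp-prefix r s≤3)))

lemma9 : (n i : ℕ) → 2 ≤ n → 1 ≤ i → i < n → FwEq (pat n i) 4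
lemma9 n i _ 1≤i i<n = forced-by-4 1≤i (<⇒≤ i<n) , λ s s<4 → not-forced-below-4 1≤i i<n s<4
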